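{- Let $G$ be a colored graph, let $(\sigma,\rho)$ be subsets of $\mathbb{N}$, and let $D$ be a $\mathbf{Red}$ $(\sigma,\rho)$-dominating set of $G$. If $v$ is a certificate for $u\in D$, then $v=u$ or $v$ is a certificate for every vertex of $N_G(v)\cap D$. If $v$ is a certificate for $u\in(V(G)\setminus D)\cap\mathbf{Red}$, then $v=u$ or $v$ is a certificate for every vertex of $N_G(v)\cap(V(G)\setminus D)\cap\mathbf{Red}$.
   Context: A colored graph is a graph $G$ with sets $\mathbf{Red},\mathbf{Blue}\subseteq V(G)$, $\mathbf{Red}\cup\mathbf{Blue}=V(G)$. A set $S$ $(\sigma,\rho)$-dominates a vertex $w$ if $|N_G(w)\cap S|\in\sigma$ when $w\in S$ and $|N_G(w)\cap S|\in\rho$ when $w\notin S$. A $\mathbf{Red}$ $(\sigma,\rho)$-dominating set is a set $D\subseteq\mathbf{Red}$ that $(\sigma,\rho)$-dominates every vertex of $\mathbf{Blue}$. For a $\mathbf{Red}$ $(\sigma,\rho)$-dominating set $D$: for $u\in D$, a vertex $v\in\mathbf{Blue}$ is a certificate for $u$ if $v$ is not $(\sigma,\rho)$-dominated by $D\setminus\{u\}$; for $u\in\mathbf{Red}\setminus D$, a vertex $v\in\mathbf{Blue}$ is a certificate for $u$ if $v$ is not $(\sigma,\rho)$-dominated by $D\cup\{u\}$. $N_G(v)$ is the open neighborhood of $v$. -}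

module Defs where

open import Data.Nat using (ℕ)
open import Data.Fin using (Fin)
open import Data.Fin.Subset using (Subset; _∈_; _∉_; _⊆_; _∩_; _∪_; _-_; ⁅_⁆; ∣_∣)
open import Data.Product using (_×_)
open import Relation.Nullary using (¬_)

record Graph (n : ℕ) : Set where
  field
    N     : Fin n → Subset n
    sym   : ∀ {u v} → u ∈ N v → v ∈ N u
    irrfl : ∀ {v} → v ∉ N v

record ColoredGraph (n : ℕ) : Set where
  field
    graph : Graph n
    Red   : Subset n
    Blue  : Subset n
    cover : ∀ (v : Fin n) → v ∈ Red ∪ Blue
  open Graph graph public

module _ {n : ℕ} (G : ColoredGraph n) (σ ρ : ℕ → Set) where
  open ColoredGraph G

  Dominates : Subset n → Fin n → Set
  Dominates S w = (w ∈ S → σ ∣ N w ∩ S ∣) × (w ∉ S → ρ ∣ N w ∩ S ∣)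

  RedDominating : Subset n → Set
  RedDominating D = D ⊆ Red × (∀ {w} → w ∈ Blue → Dominates D w)

  CertificateIn : Subset n → Fin n → Fin n → Set
  CertificateIn D u v = v ∈ Blue × ¬ Dominates (D - u) v

  CertificateOut : Subset n → Fin n → Fin n → Set
  CertificateOut D u v = v ∈ Blue × ¬ Dominates (D ∪ ⁅ u ⁆) v

module Submission where

-- Whether a set S (σ,ρ)-dominates a vertex v depends only on two data:
-- whether v ∈ S, and the number ∣ N v ∩ S ∣ of neighbours of v in S.
-- Deleting a vertex u ∈ D from D, or adding a vertex u ∉ D to D, are both
-- instances of "inserting a single fresh element", and such an insertion
-- raises ∣ A ∩ S ∣ by one when the element lies in A and leaves it unchanged
-- otherwise.  Hence, seen from v, the modified set D ∓ u looks exactly like D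
-- when u ∉ N v ∪ {v}, and the sets D ∓ u and D ∓ w look alike when u and w
-- are both neighbours of v.  So if v ≠ u is a certificate for u, then u must
-- be a neighbour of v (otherwise D ∓ u dominates v as D does), and then every
-- neighbour w of v of the same kind has D ∓ w looking like D ∓ u from v, so v
-- is a certificate for w too.

open import Defs
open import Data.Nat using (ℕ; suc)
open import Data.Nat.Properties using (suc-injective)
open import Data.Bool using (true; false)
open import Data.Vec using ([]; _∷_; here; there)
open import Data.Fin using (Fin; zero; suc; _≟_)
import Data.Fin.Properties as Fin
open import Data.Fin.Subset using (Subset; _∈_; _∉_; _∩_; _∪_; _-_; ⁅_⁆; ∣_∣; inside; outside)
open import Data.Fin.Subset.Properties
  using (_∈?_; drop-there; p─q⊆p; x∈p∧x≢y⇒x∈p-y; x∈p∪q⁺; x∈p∪q⁻; x∈⁅x⁆; x∈⁅y⁆⇒x≡y)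
open import Data.Product using (_×_; _,_)
open import Data.Sum using (_⊎_; inj₁; inj₂)
open import Data.Empty using (⊥-elim)
open import Function using (_∘_)
open import Function.Bundles using (_⇔_; mk⇔; Equivalence)
import Function.Properties.Equivalence as ⇔
open import Relation.Binary.PropositionalEquality using (_≡_; _≢_; refl; sym; trans; cong; subst)
open import Relation.Nullary using (¬_; yes; no)

open Equivalence using (to; from)

record Insertion {n : ℕ} (x : Fin n) (S S' : Subset n) : Set where
  field
    fresh  : x ∉ S
    added  : x ∈ S'
    others : ∀ {y} → y ≢ x → y ∈ S ⇔ y ∈ S'
open Insertion

tail⇔ : ∀ {n} {s s'} {S S' : Subset n} {y : Fin n}
  → suc y ∈ s ∷ S ⇔ suc y ∈ s' ∷ S' → y ∈ S ⇔ y ∈ S'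
tail⇔ e = mk⇔ (drop-there ∘ to e ∘ there) (drop-there ∘ from e ∘ there)

head-agree : ∀ {n} {s s'} {S S' : Subset n} → zero ∈ s ∷ S ⇔ zero ∈ s' ∷ S' → s ≡ s'
head-agree {s = true}  {true}  e = refl
head-agree {s = false} {false} e = refl
head-agree {s = true}  {false} e with to e here
... | ()
head-agree {s = false} {true}  e with from e here
... | ()

count-agree : ∀ {n} (A S S' : Subset n)
  → (∀ {y} → y ∈ A → y ∈ S ⇔ y ∈ S') → ∣ A ∩ S ∣ ≡ ∣ A ∩ S' ∣
count-agree [] [] [] agree = refl
count-agree (outside ∷ A) (s ∷ S) (s' ∷ S') agree =
  count-agree A S S' (tail⇔ ∘ agree ∘ there)
count-agree (inside ∷ A) (s ∷ S) (s' ∷ S') agree with head-agree (agree here)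
... | refl with s
...   | true  = cong suc (count-agree A S S' (tail⇔ ∘ agree ∘ there))
...   | false = count-agree A S S' (tail⇔ ∘ agree ∘ there)

tail-insertion : ∀ {n} {x : Fin n} {s s'} {S S' : Subset n}
  → Insertion (suc x) (s ∷ S) (s' ∷ S') → Insertion x S S'
tail-insertion ins = record
  { fresh  = fresh ins ∘ there
  ; added  = drop-there (added ins)
  ; others = λ y≢x → tail⇔ (others ins (y≢x ∘ Fin.suc-injective))
  }

count-insert : ∀ {n} (A S S' : Subset n) {x : Fin n}
  → x ∈ A → Insertion x S S' → ∣ A ∩ S' ∣ ≡ suc ∣ A ∩ S ∣
count-insert (inside ∷ A) (true ∷ S) S' here ins = ⊥-elim (fresh ins here)
count-insert (inside ∷ A) (false ∷ S) (false ∷ S') here ins with added ins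
... | ()
count-insert (inside ∷ A) (false ∷ S) (true ∷ S') here ins =
  cong suc (sym (count-agree A S S' (λ _ → tail⇔ (others ins (λ ())))))
count-insert (a ∷ A) (s ∷ S) (s' ∷ S') (there x∈A) ins
  with head-agree (others ins (λ ()))
... | refl with a | s
...   | true  | true  = cong suc (count-insert A S S' x∈A (tail-insertion ins))
...   | true  | false = count-insert A S S' x∈A (tail-insertion ins)
...   | false | _     = count-insert A S S' x∈A (tail-insertion ins)

x∉p-x : ∀ {n} (p : Subset n) (x : Fin n) → x ∉ p - x
x∉p-x (true  ∷ p) zero ()
x∉p-x (false ∷ p) zero ()
x∉p-x (s ∷ p) (suc x) (there m) = x∉p-x p x m

deletion : ∀ {n} {D : Subset n} {u : Fin n} → u ∈ D → Insertion u (D - u) D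
deletion {D = D} {u} u∈D = record
  { fresh  = x∉p-x D u
  ; added  = u∈D
  ; others = λ y≢u → mk⇔ (p─q⊆p D ⁅ u ⁆) (λ y∈D → x∈p∧x≢y⇒x∈p-y y∈D y≢u)
  }

addition : ∀ {n} {D : Subset n} {u : Fin n} → u ∉ D → Insertion u D (D ∪ ⁅ u ⁆)
addition {D = D} {u} u∉D = record
  { fresh  = u∉D
  ; added  = x∈p∪q⁺ (inj₂ (x∈⁅x⁆ u))
  ; others = λ y≢u → mk⇔ (x∈p∪q⁺ ∘ inj₁) (drop-singleton y≢u)
  }
  where
  drop-singleton : ∀ {y} → y ≢ u → y ∈ D ∪ ⁅ u ⁆ → y ∈ D
  drop-singleton {y} y≢u y∈ with x∈p∪q⁻ D ⁅ u ⁆ y∈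
  ... | inj₁ y∈D = y∈D
  ... | inj₂ y∈u = ⊥-elim (y≢u (x∈⁅y⁆⇒x≡y u y∈u))

module Domination {n : ℕ} (G : ColoredGraph n) (σ ρ : ℕ → Set) where
  open ColoredGraph G using (N; irrfl)

  neighbour≢ : ∀ {v w} → w ∈ N v → w ≢ v
  neighbour≢ w∈Nv refl = irrfl w∈Nv

  record LookAlike (v : Fin n) (S S' : Subset n) : Set where
    field
      member : v ∈ S ⇔ v ∈ S'
      count  : ∣ N v ∩ S ∣ ≡ ∣ N v ∩ S' ∣
  open LookAlike

  lookAlike-sym : ∀ {v S S'} → LookAlike v S S' → LookAlike v S' S
  lookAlike-sym l = record { member = ⇔.sym (member l) ; count = sym (count l) }

  transfer : ∀ {v S S'} → LookAlike v S S' → Dominates G σ ρ S v → Dominates G σ ρ S' v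
  transfer l (inS , outS) =
    (λ v∈S' → subst σ (count l) (inS (from (member l) v∈S'))) ,
    (λ v∉S' → subst ρ (count l) (outS (v∉S' ∘ to (member l))))

  insert-away : ∀ {v x S S'} → Insertion x S S' → x ≢ v → x ∉ N v → LookAlike v S S'
  insert-away {v} {x} {S} {S'} ins x≢v x∉Nv = record
    { member = others ins (x≢v ∘ sym)
    ; count  = count-agree (N v) S S' (λ y∈Nv → others ins (λ { refl → x∉Nv y∈Nv }))
    }

  swap-up : ∀ {v u w S T T'} → Insertion u S T → Insertion w S T'
    → u ∈ N v → w ∈ N v → LookAlike v T T'
  swap-up {v} {S = S} {T} {T'} insU insW u∈Nv w∈Nv = record
    { member = ⇔.trans (⇔.sym (others insU (neighbour≢ u∈Nv ∘ sym)))
                       (others insW (neighbour≢ w∈Nv ∘ sym))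
    ; count  = trans (count-insert (N v) S T u∈Nv insU)
                     (sym (count-insert (N v) S T' w∈Nv insW))
    }

  swap-down : ∀ {v u w S S' T} → Insertion u S T → Insertion w S' T
    → u ∈ N v → w ∈ N v → LookAlike v S S'
  swap-down {v} {S = S} {S'} {T} insU insW u∈Nv w∈Nv = record
    { member = ⇔.trans (others insU (neighbour≢ u∈Nv ∘ sym))
                       (⇔.sym (others insW (neighbour≢ w∈Nv ∘ sym)))
    ; count  = suc-injective (trans (sym (count-insert (N v) S T u∈Nv insU))
                                    (count-insert (N v) S' T w∈Nv insW))
    }

  certificate-spreads : ∀ {D : Subset n} {v u : Fin n}
    (Modified : Fin n → Subset n) (Eligible : Fin n → Set)
    → (∀ {x} → Eligible x → x ≢ v → x ∉ N v → LookAlike v D (Modified x))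
    → (∀ {x y} → Eligible x → Eligible y → x ∈ N v → y ∈ N v
         → LookAlike v (Modified x) (Modified y))
    → Dominates G σ ρ D v → Eligible u → u ≢ v → ¬ Dominates G σ ρ (Modified u) v
    → ∀ {w} → Eligible w → w ∈ N v → ¬ Dominates G σ ρ (Modified w) v
  certificate-spreads {v = v} {u} Modified Eligible away swap D-dom u-ok u≢v ¬u-dom
                      w-ok w∈Nv w-dom with u ∈? N v
  ... | yes u∈Nv = ¬u-dom (transfer (swap w-ok u-ok w∈Nv u∈Nv) w-dom)
  ... | no  u∉Nv = ¬u-dom (transfer (away u-ok u≢v u∉Nv) D-dom)

lemma7 : ∀ {n : ℕ} (G : ColoredGraph n) (σ ρ : ℕ → Set) (D : Subset n)
    → RedDominating G σ ρ D
    → (∀ (u v : Fin n) → u ∈ D → CertificateIn G σ ρ D u v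
        → v ≡ u ⊎ (∀ (w : Fin n) → w ∈ ColoredGraph.N G v → w ∈ D
                     → CertificateIn G σ ρ D w v))
      × (∀ (u v : Fin n) → u ∉ D → u ∈ ColoredGraph.Red G → CertificateOut G σ ρ D u v
        → v ≡ u ⊎ (∀ (w : Fin n) → w ∈ ColoredGraph.N G v → w ∉ D → w ∈ ColoredGraph.Red G
                     → CertificateOut G σ ρ D w v))
lemma7 {n} G σ ρ D (_ , dominated) = certificatesIn , certificatesOut
  where
  open Domination G σ ρ

  certificatesIn : ∀ (u v : Fin n) → u ∈ D → CertificateIn G σ ρ D u v
    → v ≡ u ⊎ (∀ w → w ∈ ColoredGraph.N G v → w ∈ D → CertificateIn G σ ρ D w v)
  certificatesIn u v u∈D (v∈Blue , ¬u-dom) with v ≟ u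
  ... | yes v≡u = inj₁ v≡u
  ... | no  v≢u = inj₂ λ w w∈Nv w∈D → v∈Blue ,
    certificate-spreads (D -_) (_∈ D)
      (λ x∈D x≢v x∉Nv → lookAlike-sym (insert-away (deletion x∈D) x≢v x∉Nv))
      (λ x∈D y∈D → swap-down (deletion x∈D) (deletion y∈D))
      (dominated v∈Blue) u∈D (v≢u ∘ sym) ¬u-dom w∈D w∈Nv

  certificatesOut : ∀ (u v : Fin n) → u ∉ D → u ∈ ColoredGraph.Red G → CertificateOut G σ ρ D u v
    → v ≡ u ⊎ (∀ w → w ∈ ColoredGraph.N G v → w ∉ D → w ∈ ColoredGraph.Red G
                 → CertificateOut G σ ρ D w v)
  certificatesOut u v u∉D _ (v∈Blue , ¬u-dom) with v ≟ u
  ... | yes v≡u = inj₁ v≡u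
  ... | no  v≢u = inj₂ λ w w∈Nv w∉D _ → v∈Blue ,
    certificate-spreads (λ x → D ∪ ⁅ x ⁆) (_∉ D)
      (λ x∉D x≢v x∉Nv → insert-away (addition x∉D) x≢v x∉Nv)
      (λ x∉D y∉D → swap-up (addition x∉D) (addition y∉D))
      (dominated v∈Blue) u∉D (v≢u ∘ sym) ¬u-dom w∉D w∈Nv
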